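{- Let $X=\{x\mid P\}$ be an object of $\mathbb{DCL}[ZF]$, let $\mathcal{P}_{\mathcal{S}}(X)=\{y\mid\forall x(x\in y\rightarrow P)\}$, let $\in_X=\{z\mid\exists x\exists y(z=\langle x,y\rangle\wedge\forall t(t\in y\rightarrow P(t))\wedge x\in y)\}$ and let $e_X:\in_X\to X\times\mathcal{P}_{\mathcal{S}}(X)$ be the inclusion $[\{z,z'\mid z\in\in_X\wedge z=z'\}]_{\equiv}$ (where $z\in\in_X$ abbreviates the defining formula of $\in_X$). Let $\sqsubseteq_X:\subseteq_X\to\mathcal{P}_{\mathcal{S}}(X)\times\mathcal{P}_{\mathcal{S}}(X)$ be the subobject characterized by: an arrow $f=\langle f_1,f_2\rangle:Z\to\mathcal{P}_{\mathcal{S}}(X)\times\mathcal{P}_{\mathcal{S}}(X)$ factors through $\sqsubseteq_X$ if and only if, letting $\pi:P_1\to X\times Z$ be the pullback of $e_X$ along $\mathrm{id}_X\times f_1$ and $\pi':P_2\to X\times Z$ the pullback of $e_X$ along $\mathrm{id}_X\times f_2$, the arrow $\pi$ factors through $\pi'$. Then $\pi_2\circ\sqsubseteq_X\in\mathcal{S}$ (the powerset axiom holds for $\mathcal{S}$).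
   Context: $ZF$ is Zermelo–Fraenkel set theory (classical first-order theory with equality, language with one binary relation symbol $\in$); $\langle x,y\rangle$ denotes the Kuratowski pair $\{\{x\},\{x,y\}\}$. The syntactic category $\mathbb{ZF}$ has as objects formulas in context $\{x_1,\dots,x_n\mid P\}$ ($x_i$ distinct variables, possibly none, $P$ a formula with free variables among them); an arrow $\{\mathbf{x}\mid P\}\to\{\mathbf{y}\mid Q\}$ is an equivalence class $[\{\mathbf{x}',\mathbf{y}'\mid F\}]_{\equiv}$ of formulas in context ($\mathbf{x}',\mathbf{y}'$ of the same lengths as $\mathbf{x},\mathbf{y}$) with $F\vdash_{ZF}P[\mathbf{x}'/\mathbf{x}]\wedge Q[\mathbf{y}'/\mathbf{y}]$, $F\wedge F[\mathbf{y}''/\mathbf{y}']\vdash_{ZF}\mathbf{y}'=\mathbf{y}''$, $P[\mathbf{x}'/\mathbf{x}]\vdash_{ZF}\exists\mathbf{y}'F$, two such being equivalent iff $\vdash_{ZF}F\leftrightarrow F'[\mathbf{x}'/\mathbf{x}'',\mathbf{y}'/\mathbf{y}'']$; composition of $[\{\mathbf{x}',\mathbf{y}'\mid F\}]$ and $[\{\mathbf{y}',\mathbf{z}'\mid F'\}]$ (all variables distinct) is $[\{\mathbf{x}',\mathbf{z}'\mid\exists\mathbf{y}'(F\wedge F')\}]$. $\mathbb{DCL}[ZF]$ is the full subcategory of $\mathbb{ZF}$ on objects $\{x\mid P\}$ with exactly one variable; it has finite limits, products being $\{x\mid P\}\times\{y\mid Q\}=\{z\mid\exists x\exists y(z=\langle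 x,y\rangle\wedge P\wedge Q)\}$ with the obvious projections, $\pi_2$ being the second projection. The class $\mathcal{S}$ of small maps in $\mathbb{DCL}[ZF]$: an arrow $[\{x,y\mid F\}]_{\equiv}:\{x\mid P\}\to\{y\mid Q\}$ is in $\mathcal{S}$ iff $\vdash_{ZF}\forall y\exists z\forall x(F(x,y)\leftrightarrow x\in z)$. -}

module Defs where

open import Data.Nat using (ℕ; zero; suc)
open import Data.Fin using (Fin; zero; suc; #_; _↑ʳ_)
open import Data.List using (List; []; _∷_; map)
open import Data.List.Membership.Propositional using () renaming (_∈_ to _∈ᴸ_)
open import Data.Product using (Σ; _×_; _,_)

-- Well-scoped de Bruijn formulas: Fm n = formulas with free variables
-- among n variables (index 0 = innermost/most recently bound).
-- Terms are only variables, so substitution is renaming.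

infixr 3 _⇔_
infixr 4 _⇒_
infixr 5 _∨̇_
infixr 6 _∧̇_
infix 8 _∈̇_ _≐_

data Fm (n : ℕ) : Set where
  _∈̇_ : Fin n → Fin n → Fm n
  _≐_ : Fin n → Fin n → Fm n
  ⊥̇   : Fm n
  _⇒_ : Fm n → Fm n → Fm n
  _∧̇_ : Fm n → Fm n → Fm n
  _∨̇_ : Fm n → Fm n → Fm n
  ∀̇   : Fm (suc n) → Fm n
  ∃̇   : Fm (suc n) → Fm n

¬̇_ : ∀ {n} → Fm n → Fm n
¬̇ φ = φ ⇒ ⊥̇

_⇔_ : ∀ {n} → Fm n → Fm n → Fm n
φ ⇔ ψ = (φ ⇒ ψ) ∧̇ (ψ ⇒ φ)

ext : ∀ {n m} → (Fin n → Fin m) → Fin (suc n) → Fin (suc m)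
ext ρ zero    = zero
ext ρ (suc i) = suc (ρ i)

ren : ∀ {n m} → (Fin n → Fin m) → Fm n → Fm m
ren ρ (i ∈̇ j) = ρ i ∈̇ ρ j
ren ρ (i ≐ j) = ρ i ≐ ρ j
ren ρ ⊥̇       = ⊥̇
ren ρ (φ ⇒ ψ) = ren ρ φ ⇒ ren ρ ψ
ren ρ (φ ∧̇ ψ) = ren ρ φ ∧̇ ren ρ ψ
ren ρ (φ ∨̇ ψ) = ren ρ φ ∨̇ ren ρ ψ
ren ρ (∀̇ φ)   = ∀̇ (ren (ext ρ) φ)
ren ρ (∃̇ φ)   = ∃̇ (ren (ext ρ) φ)

wk : ∀ {n} → Fm n → Fm (suc n)
wk = ren suc

sub1 : ∀ {n} → Fin n → Fin (suc n) → Fin n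
sub1 t zero    = t
sub1 t (suc i) = i

_[_] : ∀ {n} → Fm (suc n) → Fin n → Fm n
φ [ t ] = ren (sub1 t) φ

∀* : ∀ k → Fm k → Fm 0
∀* zero    φ = φ
∀* (suc k) φ = ∀* k (∀̇ φ)

sepRen : ∀ {k} → Fin (suc k) → Fin (suc (suc (suc k)))
sepRen zero    = zero
sepRen (suc i) = 3 ↑ʳ i

repRenPrem : ∀ {k} → Fin (suc (suc k)) → Fin (4 Data.Nat.+ k)
repRenPrem zero          = # 2
repRenPrem (suc zero)    = # 0
repRenPrem (suc (suc i)) = 4 ↑ʳ i

repRenConc : ∀ {k} → Fin (suc (suc k)) → Fin (4 Data.Nat.+ k)
repRenConc zero          = # 1
repRenConc (suc zero)    = # 0
repRenConc (suc (suc i)) = 4 ↑ʳ i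

data ZFAx : Fm 0 → Set where
  extensionality :
    ZFAx (∀̇ (∀̇ (∀̇ (# 0 ∈̇ # 2 ⇔ # 0 ∈̇ # 1) ⇒ # 1 ≐ # 0)))
  foundation :
    ZFAx (∀̇ (∃̇ (# 0 ∈̇ # 1) ⇒
              ∃̇ (# 0 ∈̇ # 1 ∧̇ ∀̇ (# 0 ∈̇ # 1 ⇒ ¬̇ (# 0 ∈̇ # 2)))))
  pairing :
    ZFAx (∀̇ (∀̇ (∃̇ (# 2 ∈̇ # 0 ∧̇ # 1 ∈̇ # 0))))
  union :
    ZFAx (∀̇ (∃̇ (∀̇ (∀̇ ((# 0 ∈̇ # 1 ∧̇ # 1 ∈̇ # 3) ⇒ # 0 ∈̇ # 2)))))
  powerset :
    ZFAx (∀̇ (∃̇ (∀̇ (∀̇ (# 0 ∈̇ # 1 ⇒ # 0 ∈̇ # 3) ⇒ # 0 ∈̇ # 1))))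
  infinity :
    ZFAx (∃̇ (∃̇ (# 0 ∈̇ # 1 ∧̇ ∀̇ (¬̇ (# 0 ∈̇ # 1)))
             ∧̇ ∀̇ (# 0 ∈̇ # 1 ⇒
                    ∃̇ (# 0 ∈̇ # 2 ∧̇ ∀̇ (# 0 ∈̇ # 1 ⇔ (# 0 ∈̇ # 2 ∨̇ # 0 ≐ # 2))))))
  -- separation: φ(x, p₁..pₖ) with x = variable 0
  separation : ∀ k (φ : Fm (suc k)) →
    ZFAx (∀* k (∀̇ (∃̇ (∀̇ (# 0 ∈̇ # 1 ⇔ (# 0 ∈̇ # 2 ∧̇ ren sepRen φ))))))
  -- replacement: φ(x, y, p₁..pₖ) with x = variable 0, y = variable 1
  replacement : ∀ k (φ : Fm (suc (suc k))) →
    ZFAx (∀* k (∀̇ (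
      ∀̇ (# 0 ∈̇ # 1 ⇒ ∃̇ (∀̇ (ren repRenPrem φ ⇔ # 0 ≐ # 1)))
      ⇒ ∃̇ (∀̇ (# 0 ∈̇ # 2 ⇒ ∃̇ (# 0 ∈̇ # 2 ∧̇ ren repRenConc φ))))))

data Der : (n : ℕ) → List (Fm n) → Fm n → Set where
  hyp  : ∀ {n Γ φ} → φ ∈ᴸ Γ → Der n Γ φ
  ax   : ∀ {n Γ φ} → ZFAx φ → Der n Γ (ren (λ ()) φ)
  ⇒I   : ∀ {n Γ φ ψ} → Der n (φ ∷ Γ) ψ → Der n Γ (φ ⇒ ψ)
  ⇒E   : ∀ {n Γ φ ψ} → Der n Γ (φ ⇒ ψ) → Der n Γ φ → Der n Γ ψ
  ∧I   : ∀ {n Γ φ ψ} → Der n Γ φ → Der n Γ ψ → Der n Γ (φ ∧̇ ψ)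
  ∧E₁  : ∀ {n Γ φ ψ} → Der n Γ (φ ∧̇ ψ) → Der n Γ φ
  ∧E₂  : ∀ {n Γ φ ψ} → Der n Γ (φ ∧̇ ψ) → Der n Γ ψ
  ∨I₁  : ∀ {n Γ φ ψ} → Der n Γ φ → Der n Γ (φ ∨̇ ψ)
  ∨I₂  : ∀ {n Γ φ ψ} → Der n Γ ψ → Der n Γ (φ ∨̇ ψ)
  ∨E   : ∀ {n Γ φ ψ χ} → Der n Γ (φ ∨̇ ψ) → Der n (φ ∷ Γ) χ →
         Der n (ψ ∷ Γ) χ → Der n Γ χ
  ⊥E   : ∀ {n Γ φ} → Der n Γ ⊥̇ → Der n Γ φ
  raa  : ∀ {n Γ φ} → Der n ((¬̇ φ) ∷ Γ) ⊥̇ → Der n Γ φ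
  ∀I   : ∀ {n Γ φ} → Der (suc n) (map wk Γ) φ → Der n Γ (∀̇ φ)
  ∀E   : ∀ {n Γ φ} → Der n Γ (∀̇ φ) → (t : Fin n) → Der n Γ (φ [ t ])
  ∃I   : ∀ {n Γ φ} → (t : Fin n) → Der n Γ (φ [ t ]) → Der n Γ (∃̇ φ)
  ∃E   : ∀ {n Γ φ ψ} → Der n Γ (∃̇ φ) → Der (suc n) (φ ∷ map wk Γ) (wk ψ) →
         Der n Γ ψ
  ≐refl  : ∀ {n Γ} (t : Fin n) → Der n Γ (t ≐ t)
  ≐subst : ∀ {n Γ} (φ : Fm (suc n)) {s t : Fin n} →
           Der n Γ (s ≐ t) → Der n Γ (φ [ s ]) → Der n Γ (φ [ t ])

⊢ZF : ∀ {n} → Fm n → Set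
⊢ZF {n} φ = Der n [] φ

_⊩_ : ∀ {n} → Fm n → Fm n → Set
_⊩_ {n} φ ψ = Der n (φ ∷ []) ψ

_≈_ : ∀ {n} → Fm n → Fm n → Set
φ ≈ ψ = ⊢ZF (φ ⇔ ψ)

-- An object {x | P} is a formula P : Fm 1 (x = variable 0).
-- An arrow {x|P} → {y|Q} is represented by F : Fm 2 with x = variable 0,
-- y = variable 1; arrows are compared up to provable equivalence _≈_.

ap1 : ∀ {n} → Fm 1 → Fin n → Fm n
ap1 P i = ren (λ _ → i) P

pick2 : ∀ {n} → Fin n → Fin n → Fin 2 → Fin n
pick2 i j zero    = i
pick2 i j (suc _) = j

ap2 : ∀ {n} → Fm 2 → Fin n → Fin n → Fm n
ap2 F i j = ren (pick2 i j) F

record IsArrow (P Q : Fm 1) (F : Fm 2) : Set where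
  field
    typed      : F ⊩ (ap1 P (# 0) ∧̇ ap1 Q (# 1))
    functional : _⊩_ {3} (ap2 F (# 0) (# 1) ∧̇ ap2 F (# 0) (# 2)) (# 1 ≐ # 2)
    total      : _⊩_ {1} (ap1 P (# 0)) (∃̇ (ap2 F (# 1) (# 0)))

record Arrow (P Q : Fm 1) : Set where
  constructor arr
  field
    fm    : Fm 2
    isArr : IsArrow P Q fm
open Arrow public

-- composite "G after F" (F : X → Y, G : Y → Z), as a formula
comp : Fm 2 → Fm 2 → Fm 2
comp G F = ∃̇ (ap2 F (# 1) (# 0) ∧̇ ap2 G (# 0) (# 2))

-- Kuratowski pair:  z = ⟨x , y⟩
Pair : ∀ {n} → Fin n → Fin n → Fin n → Fm n
Pair z x y =
  ∀̇ (# 0 ∈̇ suc z ⇔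
       (∀̇ (# 0 ∈̇ # 1 ⇔ # 0 ≐ suc (suc x))
        ∨̇ ∀̇ (# 0 ∈̇ # 1 ⇔ (# 0 ≐ suc (suc x) ∨̇ # 0 ≐ suc (suc y)))))

_⊗_ : Fm 1 → Fm 1 → Fm 1
P ⊗ Q = ∃̇ (∃̇ (Pair (# 2) (# 1) (# 0) ∧̇ ap1 P (# 1) ∧̇ ap1 Q (# 0)))

proj₂F : Fm 1 → Fm 1 → Fm 2
proj₂F P Q = ∃̇ (Pair (# 1) (# 0) (# 2) ∧̇ ap1 P (# 0) ∧̇ ap1 Q (# 2))

idF : Fm 1 → Fm 2
idF P = ap1 P (# 0) ∧̇ # 0 ≐ # 1

_×F_ : Fm 2 → Fm 2 → Fm 2
F ×F G = ∃̇ (∃̇ (∃̇ (∃̇ (Pair (# 4) (# 3) (# 2) ∧̇ Pair (# 5) (# 1) (# 0)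
                       ∧̇ ap2 F (# 3) (# 1) ∧̇ ap2 G (# 2) (# 0)))))

pairF : Fm 2 → Fm 2 → Fm 2
pairF F G = ∃̇ (∃̇ (Pair (# 3) (# 1) (# 0) ∧̇ ap2 F (# 2) (# 1) ∧̇ ap2 G (# 2) (# 0)))

𝒫S : Fm 1 → Fm 1
𝒫S P = ∀̇ (# 0 ∈̇ # 1 ⇒ ap1 P (# 0))

MemX : Fm 1 → Fm 1
MemX P = ∃̇ (∃̇ (Pair (# 2) (# 1) (# 0)
                ∧̇ ∀̇ (# 0 ∈̇ # 1 ⇒ ap1 P (# 0))
                ∧̇ # 1 ∈̇ # 0))

eX : Fm 1 → Fm 2
eX P = ap1 (MemX P) (# 0) ∧̇ # 0 ≐ # 1

Factors : (W V T : Fm 1) → Fm 2 → Arrow V T → Set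
Factors W V T a b = Σ (Arrow W V) λ g → comp (fm b) (fm g) ≈ a

record IsPullback (A B D : Fm 1) (e h : Fm 2) (Pb : Fm 1)
                  (π : Arrow Pb A) (q : Arrow Pb B) : Set where
  field
    commutes  : comp e (fm q) ≈ comp h (fm π)
    universal : (W : Fm 1) (a : Arrow W A) (b : Arrow W B) →
                comp e (fm b) ≈ comp h (fm a) →
                Σ (Arrow W Pb) λ u →
                  (comp (fm π) (fm u) ≈ fm a) × (comp (fm q) (fm u) ≈ fm b) ×
                  ((u' : Arrow W Pb) → comp (fm π) (fm u') ≈ fm a →
                     comp (fm q) (fm u') ≈ fm b → fm u' ≈ fm u)

Mono : ∀ {S T} → Arrow S T → Set
Mono {S} {T} m = (W : Fm 1) (g g' : Arrow W S) →
  comp (fm m) (fm g) ≈ comp (fm m) (fm g') → fm g ≈ fm g'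

Small : Fm 2 → Set
Small F = ⊢ZF {0} (∀̇ (∃̇ (∀̇ (ap2 F (# 0) (# 2) ⇔ # 0 ∈̇ # 1))))

CharSubset : (P S : Fm 1) → Arrow S (𝒫S P ⊗ 𝒫S P) → Set
CharSubset P S m =
  (Z : Fm 1) (f₁ f₂ : Arrow Z (𝒫S P)) →
  (Factors Z S (𝒫S P ⊗ 𝒫S P) (pairF (fm f₁) (fm f₂)) m →
     PullbackFactor f₁ f₂)
  × (PullbackFactor f₁ f₂ →
     Factors Z S (𝒫S P ⊗ 𝒫S P) (pairF (fm f₁) (fm f₂)) m)
  where
  PullbackFactor : ∀ {Z} → Arrow Z (𝒫S P) → Arrow Z (𝒫S P) → Set
  PullbackFactor {Z} f₁ f₂ =
    (P₁ : Fm 1) (π : Arrow P₁ (P ⊗ Z)) (q : Arrow P₁ (MemX P)) →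
    IsPullback (P ⊗ Z) (MemX P) (P ⊗ 𝒫S P) (eX P) (idF P ×F fm f₁) P₁ π q →
    (P₂ : Fm 1) (π' : Arrow P₂ (P ⊗ Z)) (q' : Arrow P₂ (MemX P)) →
    IsPullback (P ⊗ Z) (MemX P) (P ⊗ 𝒫S P) (eX P) (idF P ×F fm f₂) P₂ π' q' →
    Factors P₁ P₂ (P ⊗ Z) (fm π) π'

-- A mono m : S → 𝒫S(X) × 𝒫S(X) is injective on elements, as its kernel pair is trivial.
-- Its components f₁, f₂ satisfy f₁(s) ⊆ f₂(s): m factors through ⊑_X (through itself),
-- so the pullback of e_X along id × f₁, i.e. {(x, s) | x ∈ f₁(s)}, factors through the
-- pullback along id × f₂. Hence the fibre of π₂ ∘ m over y is the set of preimages of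
-- the pairs ⟨a, y⟩ with a ∈ 𝒫(y), a set by Powerset, Separation and Replacement.
module Submission where

open import Data.Fin using (Fin; zero; suc; #_)
open import Data.List using (List; []; _∷_; map)
open import Data.List.Membership.Propositional using () renaming (_∈_ to _∈ᴸ_)
open import Data.List.Membership.Propositional.Properties using (∈-map⁺)
open import Data.List.Relation.Binary.Subset.Propositional using (_⊆_)
open import Data.List.Relation.Binary.Subset.Propositional.Properties using (map⁺; ∷⁺ʳ)
open import Data.List.Relation.Unary.Any using (here; there)
open import Data.Nat using (ℕ; zero; suc)
open import Data.Product using (Σ; _×_; _,_; proj₁; proj₂)
open import Function using (id)
open import Relation.Binary.PropositionalEquality using (_≡_; refl; sym; trans; cong; cong₂)

open import Defs

private variable n : ℕ

ext-cong : ∀ {n m} {ρ σ : Fin n → Fin m} → (∀ i → ρ i ≡ σ i) → ∀ i → ext ρ i ≡ ext σ i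
ext-cong h zero = refl
ext-cong h (suc i) = cong suc (h i)

ren-cong : ∀ {n m} {ρ σ : Fin n → Fin m} → (∀ i → ρ i ≡ σ i) → (φ : Fm n) → ren ρ φ ≡ ren σ φ
ren-cong h (i ∈̇ j) = cong₂ _∈̇_ (h i) (h j)
ren-cong h (i ≐ j) = cong₂ _≐_ (h i) (h j)
ren-cong h ⊥̇ = refl
ren-cong h (φ ⇒ ψ) = cong₂ _⇒_ (ren-cong h φ) (ren-cong h ψ)
ren-cong h (φ ∧̇ ψ) = cong₂ _∧̇_ (ren-cong h φ) (ren-cong h ψ)
ren-cong h (φ ∨̇ ψ) = cong₂ _∨̇_ (ren-cong h φ) (ren-cong h ψ)
ren-cong h (∀̇ φ) = cong ∀̇ (ren-cong (ext-cong h) φ)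
ren-cong h (∃̇ φ) = cong ∃̇ (ren-cong (ext-cong h) φ)

ext-∘ : ∀ {n m k} (ρ : Fin m → Fin k) (σ : Fin n → Fin m) → ∀ i → ext ρ (ext σ i) ≡ ext (λ j → ρ (σ j)) i
ext-∘ ρ σ zero = refl
ext-∘ ρ σ (suc i) = refl

ren-∘ : ∀ {n m k} (ρ : Fin m → Fin k) (σ : Fin n → Fin m) (φ : Fm n) → ren ρ (ren σ φ) ≡ ren (λ i → ρ (σ i)) φ
ren-∘ ρ σ (i ∈̇ j) = refl
ren-∘ ρ σ (i ≐ j) = refl
ren-∘ ρ σ ⊥̇ = refl
ren-∘ ρ σ (φ ⇒ ψ) = cong₂ _⇒_ (ren-∘ ρ σ φ) (ren-∘ ρ σ ψ)
ren-∘ ρ σ (φ ∧̇ ψ) = cong₂ _∧̇_ (ren-∘ ρ σ φ) (ren-∘ ρ σ ψ)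
ren-∘ ρ σ (φ ∨̇ ψ) = cong₂ _∨̇_ (ren-∘ ρ σ φ) (ren-∘ ρ σ ψ)
ren-∘ ρ σ (∀̇ φ) = cong ∀̇ (trans (ren-∘ (ext ρ) (ext σ) φ) (ren-cong (ext-∘ ρ σ) φ))
ren-∘ ρ σ (∃̇ φ) = cong ∃̇ (trans (ren-∘ (ext ρ) (ext σ) φ) (ren-cong (ext-∘ ρ σ) φ))

ext-id : ∀ {n} {ρ : Fin n → Fin n} → (∀ i → ρ i ≡ i) → ∀ i → ext ρ i ≡ i
ext-id h zero = refl
ext-id h (suc i) = cong suc (h i)

ren-id : ∀ {n} {ρ : Fin n → Fin n} → (∀ i → ρ i ≡ i) → (φ : Fm n) → ren ρ φ ≡ φ
ren-id h (i ∈̇ j) = cong₂ _∈̇_ (h i) (h j)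
ren-id h (i ≐ j) = cong₂ _≐_ (h i) (h j)
ren-id h ⊥̇ = refl
ren-id h (φ ⇒ ψ) = cong₂ _⇒_ (ren-id h φ) (ren-id h ψ)
ren-id h (φ ∧̇ ψ) = cong₂ _∧̇_ (ren-id h φ) (ren-id h ψ)
ren-id h (φ ∨̇ ψ) = cong₂ _∨̇_ (ren-id h φ) (ren-id h ψ)
ren-id h (∀̇ φ) = cong ∀̇ (ren-id (ext-id h) φ)
ren-id h (∃̇ φ) = cong ∃̇ (ren-id (ext-id h) φ)

Der-weaken : ∀ {n Γ Δ φ} → Γ ⊆ Δ → Der n Γ φ → Der n Δ φ
Der-weaken h (hyp p) = hyp (h p)
Der-weaken h (ax a) = ax a
Der-weaken h (⇒I d) = ⇒I (Der-weaken (∷⁺ʳ _ h) d)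
Der-weaken h (⇒E d e) = ⇒E (Der-weaken h d) (Der-weaken h e)
Der-weaken h (∧I d e) = ∧I (Der-weaken h d) (Der-weaken h e)
Der-weaken h (∧E₁ d) = ∧E₁ (Der-weaken h d)
Der-weaken h (∧E₂ d) = ∧E₂ (Der-weaken h d)
Der-weaken h (∨I₁ d) = ∨I₁ (Der-weaken h d)
Der-weaken h (∨I₂ d) = ∨I₂ (Der-weaken h d)
Der-weaken h (∨E d e f) = ∨E (Der-weaken h d) (Der-weaken (∷⁺ʳ _ h) e) (Der-weaken (∷⁺ʳ _ h) f)
Der-weaken h (⊥E d) = ⊥E (Der-weaken h d)
Der-weaken h (raa d) = raa (Der-weaken (∷⁺ʳ _ h) d)
Der-weaken h (∀I d) = ∀I (Der-weaken (map⁺ wk h) d)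
Der-weaken h (∀E d t) = ∀E (Der-weaken h d) t
Der-weaken h (∃I t d) = ∃I t (Der-weaken h d)
Der-weaken h (∃E d e) = ∃E (Der-weaken h d) (Der-weaken (∷⁺ʳ _ (map⁺ wk h)) e)
Der-weaken h (≐refl t) = ≐refl t
Der-weaken h (≐subst φ d e) = ≐subst φ (Der-weaken h d) (Der-weaken h e)

cast : ∀ {n Γ Δ φ ψ} → Γ ≡ Δ → φ ≡ ψ → Der n Γ φ → Der n Δ ψ
cast refl refl d = d

wk-ren : ∀ {n m} (ρ : Fin n → Fin m) (φ : Fm n) → ren (ext ρ) (wk φ) ≡ wk (ren ρ φ)
wk-ren ρ φ = trans (ren-∘ (ext ρ) suc φ) (sym (ren-∘ suc ρ φ))

map-wk-ren : ∀ {n m} (ρ : Fin n → Fin m) (Γ : List (Fm n)) → map (ren (ext ρ)) (map wk Γ) ≡ map wk (map (ren ρ) Γ)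
map-wk-ren ρ [] = refl
map-wk-ren ρ (φ ∷ Γ) = cong₂ _∷_ (wk-ren ρ φ) (map-wk-ren ρ Γ)

sub-ren : ∀ {n m} (ρ : Fin n → Fin m) (t : Fin n) (φ : Fm (suc n)) → ren ρ (φ [ t ]) ≡ (ren (ext ρ) φ) [ ρ t ]
sub-ren ρ t φ = trans (ren-∘ ρ (sub1 t) φ) (trans (ren-cong h φ) (sym (ren-∘ (sub1 (ρ t)) (ext ρ) φ)))
  where
  h : ∀ i → ρ (sub1 t i) ≡ sub1 (ρ t) (ext ρ i)
  h zero = refl
  h (suc i) = refl

ren-closed : ∀ {n m} (ρ : Fin n → Fin m) (φ : Fm 0) → ren ρ (ren (λ ()) φ) ≡ ren (λ ()) φ
ren-closed ρ φ = trans (ren-∘ ρ (λ ()) φ) (ren-cong (λ ()) φ)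

Der-rename : ∀ {n m Γ φ} (ρ : Fin n → Fin m) → Der n Γ φ → Der m (map (ren ρ) Γ) (ren ρ φ)
Der-rename ρ (hyp p) = hyp (∈-map⁺ (ren ρ) p)
Der-rename ρ (ax {φ = φ} a) = cast refl (sym (ren-closed ρ φ)) (ax a)
Der-rename ρ (⇒I d) = ⇒I (Der-rename ρ d)
Der-rename ρ (⇒E d e) = ⇒E (Der-rename ρ d) (Der-rename ρ e)
Der-rename ρ (∧I d e) = ∧I (Der-rename ρ d) (Der-rename ρ e)
Der-rename ρ (∧E₁ d) = ∧E₁ (Der-rename ρ d)
Der-rename ρ (∧E₂ d) = ∧E₂ (Der-rename ρ d)
Der-rename ρ (∨I₁ d) = ∨I₁ (Der-rename ρ d)
Der-rename ρ (∨I₂ d) = ∨I₂ (Der-rename ρ d)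
Der-rename ρ (∨E d e f) = ∨E (Der-rename ρ d) (Der-rename ρ e) (Der-rename ρ f)
Der-rename ρ (⊥E d) = ⊥E (Der-rename ρ d)
Der-rename ρ (raa d) = raa (Der-rename ρ d)
Der-rename ρ (∀I {Γ = Γ} d) = ∀I (cast (map-wk-ren ρ Γ) refl (Der-rename (ext ρ) d))
Der-rename ρ (∀E {φ = φ} d t) = cast refl (sym (sub-ren ρ t φ)) (∀E (Der-rename ρ d) (ρ t))
Der-rename ρ (∃I {φ = φ} t d) = ∃I (ρ t) (cast refl (sub-ren ρ t φ) (Der-rename ρ d))
Der-rename ρ (∃E {Γ = Γ} {φ = φ} {ψ = ψ} d e) =
  ∃E (Der-rename ρ d) (cast (cong (ren (ext ρ) φ ∷_) (map-wk-ren ρ Γ)) (wk-ren ρ ψ) (Der-rename (ext ρ) e))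
Der-rename ρ (≐refl t) = ≐refl (ρ t)
Der-rename ρ (≐subst φ {s} {t} d e) =
  cast refl (sym (sub-ren ρ t φ)) (≐subst (ren (ext ρ) φ) (Der-rename ρ d) (cast refl (sub-ren ρ s φ) (Der-rename ρ e)))

-- A1 P i is P(i) and A2 F i j is F(i, j) for formulas P, F of the ambient category;
-- renaming only touches the arguments, so instances of P and F stay recognisable to the
-- type checker. R2 F is F itself, read with free variables 0 and 1.
infixr 3 _⇔'_
infixr 4 _⇒'_
infixr 5 _∨'_
infixr 6 _∧'_
infix 8 _∈'_ _≐'_

data Fmᴬ : ℕ → Set where
  _∈'_ : ∀ {n} → Fin n → Fin n → Fmᴬ n
  _≐'_ : ∀ {n} → Fin n → Fin n → Fmᴬ n
  _⇒'_ : ∀ {n} → Fmᴬ n → Fmᴬ n → Fmᴬ n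
  _∧'_ : ∀ {n} → Fmᴬ n → Fmᴬ n → Fmᴬ n
  _∨'_ : ∀ {n} → Fmᴬ n → Fmᴬ n → Fmᴬ n
  ∀'   : ∀ {n} → Fmᴬ (suc n) → Fmᴬ n
  ∃'   : ∀ {n} → Fmᴬ (suc n) → Fmᴬ n
  A1   : ∀ {n} → Fm 1 → Fin n → Fmᴬ n
  A2   : ∀ {n} → Fm 2 → Fin n → Fin n → Fmᴬ n
  R2   : Fm 2 → Fmᴬ 2

_⇔'_ : ∀ {n} → Fmᴬ n → Fmᴬ n → Fmᴬ n
φ ⇔' ψ = (φ ⇒' ψ) ∧' (ψ ⇒' φ)

⟦_⟧ : ∀ {n} → Fmᴬ n → Fm n
⟦ i ∈' j ⟧ = i ∈̇ j
⟦ i ≐' j ⟧ = i ≐ j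
⟦ φ ⇒' ψ ⟧ = ⟦ φ ⟧ ⇒ ⟦ ψ ⟧
⟦ φ ∧' ψ ⟧ = ⟦ φ ⟧ ∧̇ ⟦ ψ ⟧
⟦ φ ∨' ψ ⟧ = ⟦ φ ⟧ ∨̇ ⟦ ψ ⟧
⟦ ∀' φ ⟧ = ∀̇ ⟦ φ ⟧
⟦ ∃' φ ⟧ = ∃̇ ⟦ φ ⟧
⟦ A1 φ i ⟧ = ap1 φ i
⟦ A2 φ i j ⟧ = ap2 φ i j
⟦ R2 φ ⟧ = φ

renᴬ : ∀ {n m} → (Fin n → Fin m) → Fmᴬ n → Fmᴬ m
renᴬ ρ (i ∈' j) = ρ i ∈' ρ j
renᴬ ρ (i ≐' j) = ρ i ≐' ρ j
renᴬ ρ (φ ⇒' ψ) = renᴬ ρ φ ⇒' renᴬ ρ ψ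
renᴬ ρ (φ ∧' ψ) = renᴬ ρ φ ∧' renᴬ ρ ψ
renᴬ ρ (φ ∨' ψ) = renᴬ ρ φ ∨' renᴬ ρ ψ
renᴬ ρ (∀' φ) = ∀' (renᴬ (ext ρ) φ)
renᴬ ρ (∃' φ) = ∃' (renᴬ (ext ρ) φ)
renᴬ ρ (A1 φ i) = A1 φ (ρ i)
renᴬ ρ (A2 φ i j) = A2 φ (ρ i) (ρ j)
renᴬ ρ (R2 φ) = A2 φ (ρ zero) (ρ (suc zero))

wkᴬ : ∀ {n} → Fmᴬ n → Fmᴬ (suc n)
wkᴬ = renᴬ suc

_[_]ᴬ : ∀ {n} → Fmᴬ (suc n) → Fin n → Fmᴬ n
φ [ t ]ᴬ = renᴬ (sub1 t) φ

⟦⟧-ren : ∀ {n m} (ρ : Fin n → Fin m) (e : Fmᴬ n) → ⟦ renᴬ ρ e ⟧ ≡ ren ρ ⟦ e ⟧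
⟦⟧-ren ρ (i ∈' j) = refl
⟦⟧-ren ρ (i ≐' j) = refl
⟦⟧-ren ρ (φ ⇒' ψ) = cong₂ _⇒_ (⟦⟧-ren ρ φ) (⟦⟧-ren ρ ψ)
⟦⟧-ren ρ (φ ∧' ψ) = cong₂ _∧̇_ (⟦⟧-ren ρ φ) (⟦⟧-ren ρ ψ)
⟦⟧-ren ρ (φ ∨' ψ) = cong₂ _∨̇_ (⟦⟧-ren ρ φ) (⟦⟧-ren ρ ψ)
⟦⟧-ren ρ (∀' φ) = cong ∀̇ (⟦⟧-ren (ext ρ) φ)
⟦⟧-ren ρ (∃' φ) = cong ∃̇ (⟦⟧-ren (ext ρ) φ)
⟦⟧-ren ρ (A1 φ i) = sym (ren-∘ ρ (λ _ → i) φ)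
⟦⟧-ren ρ (A2 φ i j) = trans (ren-cong h φ) (sym (ren-∘ ρ (pick2 i j) φ))
  where
  h : ∀ k → pick2 (ρ i) (ρ j) k ≡ ρ (pick2 i j k)
  h zero = refl
  h (suc k) = refl
⟦⟧-ren ρ (R2 φ) = ren-cong h φ
  where
  h : ∀ k → pick2 (ρ zero) (ρ (suc zero)) k ≡ ρ k
  h zero = refl
  h (suc zero) = refl

⟦⟧-map-wk : ∀ {n} (Γ : List (Fmᴬ n)) → map ⟦_⟧ (map wkᴬ Γ) ≡ map wk (map ⟦_⟧ Γ)
⟦⟧-map-wk [] = refl
⟦⟧-map-wk (φ ∷ Γ) = cong₂ _∷_ (⟦⟧-ren suc φ) (⟦⟧-map-wk Γ)

data Derᴬ : (n : ℕ) → List (Fmᴬ n) → Fmᴬ n → Set where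
  assume   : ∀ {n Γ φ} → φ ∈ᴸ Γ → Derᴬ n Γ φ
  ⇒i   : ∀ {n Γ φ ψ} → Derᴬ n (φ ∷ Γ) ψ → Derᴬ n Γ (φ ⇒' ψ)
  ⇒e   : ∀ {n Γ φ ψ} → Derᴬ n Γ (φ ⇒' ψ) → Derᴬ n Γ φ → Derᴬ n Γ ψ
  ∧i   : ∀ {n Γ φ ψ} → Derᴬ n Γ φ → Derᴬ n Γ ψ → Derᴬ n Γ (φ ∧' ψ)
  ∧e1  : ∀ {n Γ φ ψ} → Derᴬ n Γ (φ ∧' ψ) → Derᴬ n Γ φ
  ∧e2  : ∀ {n Γ φ ψ} → Derᴬ n Γ (φ ∧' ψ) → Derᴬ n Γ ψ
  ∨i1  : ∀ {n Γ φ ψ} → Derᴬ n Γ φ → Derᴬ n Γ (φ ∨' ψ)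
  ∨i2  : ∀ {n Γ φ ψ} → Derᴬ n Γ ψ → Derᴬ n Γ (φ ∨' ψ)
  ∨e   : ∀ {n Γ φ ψ χ} → Derᴬ n Γ (φ ∨' ψ) → Derᴬ n (φ ∷ Γ) χ → Derᴬ n (ψ ∷ Γ) χ → Derᴬ n Γ χ
  ∀i   : ∀ {n Γ φ} → Derᴬ (suc n) (map wkᴬ Γ) φ → Derᴬ n Γ (∀' φ)
  ∀e   : ∀ {n Γ φ} → Derᴬ n Γ (∀' φ) → (t : Fin n) → Derᴬ n Γ (φ [ t ]ᴬ)
  ∃i   : ∀ {n Γ φ} → (t : Fin n) → Derᴬ n Γ (φ [ t ]ᴬ) → Derᴬ n Γ (∃' φ)
  ∃e   : ∀ {n Γ φ ψ} → Derᴬ n Γ (∃' φ) → Derᴬ (suc n) (φ ∷ map wkᴬ Γ) (wkᴬ ψ) → Derᴬ n Γ ψ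
  rfl  : ∀ {n Γ} (t : Fin n) → Derᴬ n Γ (t ≐' t)
  sbst : ∀ {n Γ} (φ : Fmᴬ (suc n)) {s t : Fin n} → Derᴬ n Γ (s ≐' t) → Derᴬ n Γ (φ [ s ]ᴬ) →
    Derᴬ n Γ (φ [ t ]ᴬ)
  der  : ∀ {n Γ φ} → Der n (map ⟦_⟧ Γ) ⟦ φ ⟧ → Derᴬ n Γ φ

sound : ∀ {n Γ φ} → Derᴬ n Γ φ → Der n (map ⟦_⟧ Γ) ⟦ φ ⟧
sound (assume p) = hyp (∈-map⁺ ⟦_⟧ p)
sound (⇒i d) = ⇒I (sound d)
sound (⇒e d e) = ⇒E (sound d) (sound e)
sound (∧i d e) = ∧I (sound d) (sound e)
sound (∧e1 d) = ∧E₁ (sound d)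
sound (∧e2 d) = ∧E₂ (sound d)
sound (∨i1 d) = ∨I₁ (sound d)
sound (∨i2 d) = ∨I₂ (sound d)
sound (∨e d e f) = ∨E (sound d) (sound e) (sound f)
sound (∀i {Γ = Γ} d) = ∀I (cast (⟦⟧-map-wk Γ) refl (sound d))
sound (∀e {φ = φ} d t) = cast refl (sym (⟦⟧-ren (sub1 t) φ)) (∀E (sound d) t)
sound (∃i {φ = φ} t d) = ∃I t (cast refl (⟦⟧-ren (sub1 t) φ) (sound d))
sound (∃e {Γ = Γ} {φ = φ} {ψ = ψ} d e) =
  ∃E (sound d) (cast (cong (⟦ φ ⟧ ∷_) (⟦⟧-map-wk Γ)) (⟦⟧-ren suc ψ) (sound e))
sound (rfl t) = ≐refl t
sound (sbst φ {s} {t} d e) =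
  cast refl (sym (⟦⟧-ren (sub1 t) φ)) (≐subst ⟦ φ ⟧ (sound d) (cast refl (⟦⟧-ren (sub1 s) φ) (sound e)))
sound (der d) = d

weaken₁ : ∀ {n Γ φ ψ} → Derᴬ n Γ φ → Derᴬ n (ψ ∷ Γ) φ
weaken₁ {ψ = ψ} d = der (Der-weaken (map⁺ ⟦_⟧ (there {x = ψ})) (sound d))

instantiate : ∀ {k n Γ} (e : Fmᴬ k) → Der k [] ⟦ e ⟧ → (ρ : Fin k → Fin n) → Derᴬ n Γ (renᴬ ρ e)
instantiate e d ρ = der (Der-weaken (λ ()) (cast refl (sym (⟦⟧-ren ρ e)) (Der-rename ρ d)))

unfold₁ : ∀ {n Γ} (e : Fmᴬ 1) {i : Fin n} → Derᴬ n Γ (A1 ⟦ e ⟧ i) → Derᴬ n Γ (renᴬ (λ _ → i) e)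
unfold₁ e {i} d = der (cast refl (sym (⟦⟧-ren (λ _ → i) e)) (sound d))

fold₁ : ∀ {n Γ} (e : Fmᴬ 1) {i : Fin n} → Derᴬ n Γ (renᴬ (λ _ → i) e) → Derᴬ n Γ (A1 ⟦ e ⟧ i)
fold₁ e {i} d = der (cast refl (⟦⟧-ren (λ _ → i) e) (sound d))

unfold₂ : ∀ {n Γ} (e : Fmᴬ 2) {i j : Fin n} → Derᴬ n Γ (A2 ⟦ e ⟧ i j) → Derᴬ n Γ (renᴬ (pick2 i j) e)
unfold₂ e {i} {j} d = der (cast refl (sym (⟦⟧-ren (pick2 i j) e)) (sound d))

fold₂ : ∀ {n Γ} (e : Fmᴬ 2) {i j : Fin n} → Derᴬ n Γ (renᴬ (pick2 i j) e) → Derᴬ n Γ (A2 ⟦ e ⟧ i j)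
fold₂ e {i} {j} d = der (cast refl (⟦⟧-ren (pick2 i j) e) (sound d))

pick2-id : ∀ i → pick2 zero (suc zero) i ≡ i
pick2-id zero = refl
pick2-id (suc zero) = refl

R2⇒A2 : ∀ {Γ} {F : Fm 2} → Derᴬ 2 Γ (R2 F) → Derᴬ 2 Γ (A2 F zero (suc zero))
R2⇒A2 {F = F} d = der (cast refl (sym (ren-id pick2-id F)) (sound d))

A2⇒R2 : ∀ {Γ} {F : Fm 2} → Derᴬ 2 Γ (A2 F zero (suc zero)) → Derᴬ 2 Γ (R2 F)
A2⇒R2 {F = F} d = der (cast refl (ren-id pick2-id F) (sound d))

instantiate-∀* : ∀ {m Γ} (k : ℕ) (ψ : Fm k) (σ : Fin k → Fin m) → Der m Γ (ren (λ ()) (∀* k ψ)) → Der m Γ (ren σ ψ)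
instantiate-∀* zero ψ σ d = cast refl (ren-cong (λ ()) ψ) d
instantiate-∀* (suc k) ψ σ d =
  cast refl (trans (ren-∘ (sub1 (σ zero)) (ext (λ i → σ (suc i))) ψ) (ren-cong h ψ))
    (∀E (instantiate-∀* k (∀̇ ψ) (λ i → σ (suc i)) d) (σ zero))
  where
  h : ∀ i → sub1 (σ zero) (ext (λ j → σ (suc j)) i) ≡ σ i
  h zero = refl
  h (suc i) = refl

separation-ax : ∀ {n Γ} (e : Fmᴬ (suc n)) →
  Derᴬ n Γ (∀' (∃' (∀' (# 0 ∈' # 1 ⇔' (# 0 ∈' # 2 ∧' renᴬ sepRen e)))))
separation-ax {n} e = der (cast refl eq (instantiate-∀* n _ id (ax (separation n ⟦ e ⟧))))
  where
  eq = trans (ren-id (λ i → refl) _)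
        (cong (λ χ → ∀̇ (∃̇ (∀̇ (# 0 ∈̇ # 1 ⇔ (# 0 ∈̇ # 2 ∧̇ χ))))) (sym (⟦⟧-ren sepRen e)))

replacement-ax : ∀ {n Γ} (e : Fmᴬ (suc (suc n))) →
  Derᴬ n Γ (∀' (∀' (# 0 ∈' # 1 ⇒' ∃' (∀' (renᴬ repRenPrem e ⇔' # 0 ≐' # 1)))
            ⇒' ∃' (∀' (# 0 ∈' # 2 ⇒' ∃' (# 0 ∈' # 2 ∧' renᴬ repRenConc e)))))
replacement-ax {n} e = der (cast refl eq (instantiate-∀* n _ id (ax (replacement n ⟦ e ⟧))))
  where
  eq = trans (ren-id (λ i → refl) _)
        (cong₂ (λ χ χ' → ∀̇ (∀̇ (# 0 ∈̇ # 1 ⇒ ∃̇ (∀̇ (χ ⇔ # 0 ≐ # 1)))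
            ⇒ ∃̇ (∀̇ (# 0 ∈̇ # 2 ⇒ ∃̇ (# 0 ∈̇ # 2 ∧̇ χ')))))
          (sym (⟦⟧-ren repRenPrem e)) (sym (⟦⟧-ren repRenConc e)))

extensionality-ax : ∀ {n Γ} → Derᴬ n Γ (∀' (∀' (∀' (# 0 ∈' # 2 ⇔' # 0 ∈' # 1) ⇒' # 1 ≐' # 0)))
extensionality-ax = der (ax extensionality)

pairing-ax : ∀ {n Γ} → Derᴬ n Γ (∀' (∀' (∃' (# 2 ∈' # 0 ∧' # 1 ∈' # 0))))
pairing-ax = der (ax pairing)

powerset-ax : ∀ {n Γ} → Derᴬ n Γ (∀' (∃' (∀' (∀' (# 0 ∈' # 1 ⇒' # 0 ∈' # 3) ⇒' # 0 ∈' # 1))))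
powerset-ax = der (ax powerset)

h0 : ∀ {Γ a} → Derᴬ n (a ∷ Γ) a
h0 = assume (here refl)
h1 : ∀ {Γ a b} → Derᴬ n (b ∷ a ∷ Γ) a
h1 = assume (there (here refl))
h2 : ∀ {Γ a b c} → Derᴬ n (c ∷ b ∷ a ∷ Γ) a
h2 = assume (there (there (here refl)))
h3 : ∀ {Γ a b c d} → Derᴬ n (d ∷ c ∷ b ∷ a ∷ Γ) a
h3 = assume (there (there (there (here refl))))
h4 : ∀ {Γ a b c d e} → Derᴬ n (e ∷ d ∷ c ∷ b ∷ a ∷ Γ) a
h4 = assume (there (there (there (there (here refl)))))
h5 : ∀ {Γ a b c d e f} → Derᴬ n (f ∷ e ∷ d ∷ c ∷ b ∷ a ∷ Γ) a
h5 = assume (there (there (there (there (there (here refl))))))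
h6 : ∀ {Γ a b c d e f g} → Derᴬ n (g ∷ f ∷ e ∷ d ∷ c ∷ b ∷ a ∷ Γ) a
h6 = assume (there (there (there (there (there (there (here refl)))))))
h7 : ∀ {Γ a b c d e f g h} → Derᴬ n (h ∷ g ∷ f ∷ e ∷ d ∷ c ∷ b ∷ a ∷ Γ) a
h7 = assume (there (there (there (there (there (there (there (here refl))))))))
h8 : ∀ {Γ a b c d e f g h i} → Derᴬ n (i ∷ h ∷ g ∷ f ∷ e ∷ d ∷ c ∷ b ∷ a ∷ Γ) a
h8 = assume (there (there (there (there (there (there (there (there (here refl)))))))))
h9 : ∀ {Γ a b c d e f g h i j} → Derᴬ n (j ∷ i ∷ h ∷ g ∷ f ∷ e ∷ d ∷ c ∷ b ∷ a ∷ Γ) a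
h9 = assume (there (there (there (there (there (there (there (there (there (here refl))))))))))

cut : ∀ {Γ φ ψ} → Derᴬ n Γ φ → Derᴬ n (φ ∷ Γ) ψ → Derᴬ n Γ ψ
cut d k = ⇒e (⇒i k) d

⇔i : ∀ {Γ φ ψ} → Derᴬ n (φ ∷ Γ) ψ → Derᴬ n (ψ ∷ Γ) φ → Derᴬ n Γ (φ ⇔' ψ)
⇔i a b = ∧i (⇒i a) (⇒i b)

⇔e→ : ∀ {Γ φ ψ} → Derᴬ n Γ (φ ⇔' ψ) → Derᴬ n Γ φ → Derᴬ n Γ ψ
⇔e→ d x = ⇒e (∧e1 d) x

⇔e← : ∀ {Γ φ ψ} → Derᴬ n Γ (φ ⇔' ψ) → Derᴬ n Γ ψ → Derᴬ n Γ φ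
⇔e← d x = ⇒e (∧e2 d) x

≐sym : ∀ {Γ} {s t : Fin n} → Derᴬ n Γ (s ≐' t) → Derᴬ n Γ (t ≐' s)
≐sym {s = s} d = sbst (# 0 ≐' suc s) d (rfl s)

≐trans : ∀ {Γ} {s t u : Fin n} → Derᴬ n Γ (s ≐' t) → Derᴬ n Γ (t ≐' u) → Derᴬ n Γ (s ≐' u)
≐trans {s = s} d e = sbst (suc s ≐' # 0) e d

subst-∈ˡ : ∀ {Γ} {s t u : Fin n} → Derᴬ n Γ (s ≐' t) → Derᴬ n Γ (s ∈' u) → Derᴬ n Γ (t ∈' u)
subst-∈ˡ {u = u} d e = sbst (# 0 ∈' suc u) d e

subst-∈ʳ : ∀ {Γ} {s t u : Fin n} → Derᴬ n Γ (s ≐' t) → Derᴬ n Γ (u ∈' s) → Derᴬ n Γ (u ∈' t)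
subst-∈ʳ {u = u} d e = sbst (suc u ∈' # 0) d e

subst-A1 : ∀ {Γ} {X : Fm 1} {i j : Fin n} → Derᴬ n Γ (i ≐' j) → Derᴬ n Γ (A1 X i) → Derᴬ n Γ (A1 X j)
subst-A1 {X = X} e d = sbst (A1 X (# 0)) e d

subst-A2ˡ : ∀ {Γ} {F : Fm 2} {i j k : Fin n} → Derᴬ n Γ (i ≐' j) → Derᴬ n Γ (A2 F i k) → Derᴬ n Γ (A2 F j k)
subst-A2ˡ {F = F} {k = k} e d = sbst (A2 F (# 0) (suc k)) e d

subst-A2ʳ : ∀ {Γ} {F : Fm 2} {i j k : Fin n} → Derᴬ n Γ (i ≐' j) → Derᴬ n Γ (A2 F k i) → Derᴬ n Γ (A2 F k j)
subst-A2ʳ {F = F} {k = k} e d = sbst (A2 F (suc k) (# 0)) e d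

-- Kuratowski pairs

Singleton : ∀ {n} → Fin n → Fin n → Fmᴬ n
Singleton w x = ∀' (# 0 ∈' suc w ⇔' # 0 ≐' suc x)

Doubleton : ∀ {n} → Fin n → Fin n → Fin n → Fmᴬ n
Doubleton w x y = ∀' (# 0 ∈' suc w ⇔' (# 0 ≐' suc x ∨' # 0 ≐' suc y))

IsPair : ∀ {n} → Fin n → Fin n → Fin n → Fmᴬ n
IsPair z x y = ∀' (# 0 ∈' suc z ⇔' (Singleton (# 0) (suc x) ∨' Doubleton (# 0) (suc x) (suc y)))

extensional : ∀ {Γ} {u v : Fin n} → Derᴬ n Γ (∀' (# 0 ∈' suc u ⇔' # 0 ∈' suc v)) → Derᴬ n Γ (u ≐' v)
extensional {u = u} {v} d = ⇒e (∀e (∀e extensionality-ax u) v) d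

same-members⇒≐ : ∀ {Γ} {u v : Fin n} (χ : Fmᴬ (suc n)) → Derᴬ n Γ (∀' (# 0 ∈' suc u ⇔' χ)) →
  Derᴬ n Γ (∀' (# 0 ∈' suc v ⇔' χ)) → Derᴬ n Γ (u ≐' v)
same-members⇒≐ χ d1 d2 = cut d1 (cut (weaken₁ d2) (extensional (∀i (⇔i
    (⇔e← (∀e h1 (# 0)) (⇔e→ (∀e h2 (# 0)) h0))
    (⇔e← (∀e h2 (# 0)) (⇔e→ (∀e h1 (# 0)) h0))))))

doubleton-exists : ∀ {Γ} (x y : Fin n) → Derᴬ n Γ (∃' (Doubleton (# 0) (suc x) (suc y)))
doubleton-exists x y =
  ∃e (∀e (∀e pairing-ax x) y)
    (∃e (∀e (separation-ax (# 0 ≐' suc (suc x) ∨' # 0 ≐' suc (suc y))) (# 0))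
      (∃i (# 0) (∀i (⇔i
        (∧e2 (⇔e→ (∀e h1 (# 0)) h0))
        (⇔e← (∀e h1 (# 0)) (∧i
           (∨e h0 (subst-∈ˡ (≐sym h0) (∧e1 h3)) (subst-∈ˡ (≐sym h0) (∧e2 h3)))
           h0))))))

singleton-∋ : ∀ {Γ} {s x : Fin n} → Derᴬ n Γ (Singleton s x) → Derᴬ n Γ (x ∈' s)
singleton-∋ {x = x} d = ⇔e← (∀e d x) (rfl x)
singleton-∈ : ∀ {Γ} {s x w : Fin n} → Derᴬ n Γ (Singleton s x) → Derᴬ n Γ (w ∈' s) → Derᴬ n Γ (w ≐' x)
singleton-∈ {w = w} d e = ⇔e→ (∀e d w) e
doubleton-∋ˡ : ∀ {Γ} {d x y : Fin n} → Derᴬ n Γ (Doubleton d x y) → Derᴬ n Γ (x ∈' d)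
doubleton-∋ˡ {x = x} d = ⇔e← (∀e d x) (∨i1 (rfl x))
doubleton-∋ʳ : ∀ {Γ} {d x y : Fin n} → Derᴬ n Γ (Doubleton d x y) → Derᴬ n Γ (y ∈' d)
doubleton-∋ʳ {y = y} d = ⇔e← (∀e d y) (∨i2 (rfl y))
doubleton-∈ : ∀ {Γ} {d x y w : Fin n} → Derᴬ n Γ (Doubleton d x y) → Derᴬ n Γ (w ∈' d) →
  Derᴬ n Γ (w ≐' x ∨' w ≐' y)
doubleton-∈ {w = w} d e = ⇔e→ (∀e d w) e
pair-∋ : ∀ {Γ} {z x y w : Fin n} → Derᴬ n Γ (IsPair z x y) →
  Derᴬ n Γ (Singleton w x ∨' Doubleton w x y) → Derᴬ n Γ (w ∈' z)
pair-∋ {w = w} d e = ⇔e← (∀e d w) e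
pair-∈ : ∀ {Γ} {z x y w : Fin n} → Derᴬ n Γ (IsPair z x y) → Derᴬ n Γ (w ∈' z) →
  Derᴬ n Γ (Singleton w x ∨' Doubleton w x y)
pair-∈ {w = w} d e = ⇔e→ (∀e d w) e

singleton-exists : ∀ {Γ} (x : Fin n) → Derᴬ n Γ (∃' (Singleton (# 0) (suc x)))
singleton-exists x = ∃e (doubleton-exists x x) (∃i (# 0) (∀i (⇔i
   (∨e (⇔e→ (∀e h1 (# 0)) h0) h0 h0)
   (⇔e← (∀e h1 (# 0)) (∨i1 h0)))))

pair-exists : ∀ {Γ} (x y : Fin n) → Derᴬ n Γ (∃' (IsPair (# 0) (suc x) (suc y)))
pair-exists x y =
  ∃e (singleton-exists x) (∃e (doubleton-exists (suc x) (suc y)) (∃e (doubleton-exists (# 1) (# 0))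
    (∃i (# 0) (∀i (⇔i
      (∨e (⇔e→ (∀e h1 (# 0)) h0)
         (∨i1 (sbst (Singleton (# 0) (suc (suc (suc (suc (suc x)))))) (≐sym h0) h4))
         (∨i2 (sbst (Doubleton (# 0) (suc (suc (suc (suc (suc x))))) (suc (suc (suc (suc (suc y)))))) (≐sym h0) h3)))
      (⇔e← (∀e h1 (# 0)) (∨e h0
         (∨i1 (same-members⇒≐ (# 0 ≐' suc (suc (suc (suc (suc x))))) h0 h4))
         (∨i2 (same-members⇒≐ (# 0 ≐' suc (suc (suc (suc (suc x)))) ∨' # 0 ≐' suc (suc (suc (suc (suc y))))) h0 h3)))))))))

pair-unique : ∀ {Γ} {z z' x y : Fin n} → Derᴬ n Γ (IsPair z x y) → Derᴬ n Γ (IsPair z' x y) →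
  Derᴬ n Γ (z ≐' z')
pair-unique {x = x} {y} d e = same-members⇒≐ (Singleton (# 0) (suc x) ∨' Doubleton (# 0) (suc x) (suc y)) d e

pair-injectiveˡ : ∀ {Γ} {z x y x' y' : Fin n} → Derᴬ n Γ (IsPair z x y) → Derᴬ n Γ (IsPair z x' y') →
  Derᴬ n Γ (x ≐' x')
pair-injectiveˡ {x = x} d e = cut d (cut (weaken₁ e) (∃e (singleton-exists x)
   (∨e (pair-∈ h1 (pair-∋ h2 (∨i1 h0)))
      (singleton-∈ h0 (singleton-∋ h1))
      (≐sym (singleton-∈ h1 (doubleton-∋ˡ h0))))))

pair-second-cases : ∀ {Γ} {z x y x' y' : Fin n} → Derᴬ n Γ (IsPair z x y) →
  Derᴬ n Γ (IsPair z x' y') → Derᴬ n Γ (y ≐' x' ∨' y ≐' y')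
pair-second-cases {x = x} {y} d e = cut d (cut (weaken₁ e) (∃e (doubleton-exists x y)
   (∨e (pair-∈ h1 (pair-∋ h2 (∨i2 h0)))
      (∨i1 (singleton-∈ h0 (doubleton-∋ʳ h1)))
      (doubleton-∈ h0 (doubleton-∋ʳ h1)))))

pair-injectiveʳ : ∀ {Γ} {z x y x' y' : Fin n} → Derᴬ n Γ (IsPair z x y) → Derᴬ n Γ (IsPair z x' y') →
  Derᴬ n Γ (y ≐' y')
pair-injectiveʳ d e = cut (pair-injectiveˡ d e) (∨e (pair-second-cases (weaken₁ d) (weaken₁ e))
   (∨e (pair-second-cases (weaken₁ (weaken₁ e)) (weaken₁ (weaken₁ d)))
      (≐trans (≐trans h1 (≐sym h2)) (≐sym h0))
      (≐sym h0))
   h0)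

subst-pair : ∀ {Γ} {z z' x y : Fin n} → Derᴬ n Γ (z ≐' z') → Derᴬ n Γ (IsPair z x y) →
  Derᴬ n Γ (IsPair z' x y)
subst-pair {x = x} {y} e d = sbst (IsPair (# 0) (suc x) (suc y)) e d

subst-pairˡ : ∀ {Γ} {z x x' y : Fin n} → Derᴬ n Γ (x ≐' x') → Derᴬ n Γ (IsPair z x y) →
  Derᴬ n Γ (IsPair z x' y)
subst-pairˡ {z = z} {y = y} e d = sbst (IsPair (suc z) (# 0) (suc y)) e d

subst-pairʳ : ∀ {Γ} {z x y y' : Fin n} → Derᴬ n Γ (y ≐' y') → Derᴬ n Γ (IsPair z x y) →
  Derᴬ n Γ (IsPair z x y')
subst-pairʳ {z = z} {x = x} e d = sbst (IsPair (suc z) (suc x) (# 0)) e d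

pick3 : ∀ {n} → Fin n → Fin n → Fin n → Fin 3 → Fin n
pick3 a b c zero = a
pick3 a b c (suc zero) = b
pick3 a b c (suc (suc zero)) = c

module _ {X Y : Fm 1} (f : Arrow X Y) where
  private F = fm f
  arrow-typed : ∀ {Γ} {i j : Fin n} → Derᴬ n Γ (A2 F i j) → Derᴬ n Γ (A1 X i ∧' A1 Y j)
  arrow-typed {i = i} {j} = ⇒e (instantiate (R2 F ⇒' (A1 X (# 0) ∧' A1 Y (# 1)))
    (⇒I (IsArrow.typed (isArr f))) (pick2 i j))
  arrow-functional : ∀ {Γ} {i j k : Fin n} → Derᴬ n Γ (A2 F i j) → Derᴬ n Γ (A2 F i k) → Derᴬ n Γ (j ≐' k)
  arrow-functional {i = i} {j} {k} d e = ⇒e (instantiate (A2 F (# 0) (# 1) ∧' A2 F (# 0) (# 2) ⇒' # 1 ≐' # 2)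
    (⇒I (IsArrow.functional (isArr f))) (pick3 i j k)) (∧i d e)
  arrow-total : ∀ {Γ} {i : Fin n} → Derᴬ n Γ (A1 X i) → Derᴬ n Γ (∃' (A2 F (suc i) (# 0)))
  arrow-total {i = i} = ⇒e (instantiate (A1 X (# 0) ⇒' ∃' (A2 F (# 1) (# 0)))
    (⇒I (IsArrow.total (isArr f))) (λ _ → i))

mkArrow : (X Y : Fm 1) (F : Fmᴬ 2) →
  Derᴬ 2 (F ∷ []) (A1 X (# 0) ∧' A1 Y (# 1)) →
  Derᴬ 3 ((A2 ⟦ F ⟧ (# 0) (# 1) ∧' A2 ⟦ F ⟧ (# 0) (# 2)) ∷ []) (# 1 ≐' # 2) →
  Derᴬ 1 (A1 X (# 0) ∷ []) (∃' (A2 ⟦ F ⟧ (# 1) (# 0))) → Arrow X Y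
mkArrow X Y F t f o = arr ⟦ F ⟧ (record { typed = sound t ; functional = sound f ; total = sound o })

-- Each of these denotes, definitionally, the construction of Defs it is named after.
⊗ᴬ : Fm 1 → Fm 1 → Fmᴬ 1
⊗ᴬ A B = ∃' (∃' (IsPair (# 2) (# 1) (# 0) ∧' A1 A (# 1) ∧' A1 B (# 0)))

𝒫Sᴬ : Fm 1 → Fmᴬ 1
𝒫Sᴬ A = ∀' (# 0 ∈' # 1 ⇒' A1 A (# 0))

MemXᴬ : Fm 1 → Fmᴬ 1
MemXᴬ A = ∃' (∃' (IsPair (# 2) (# 1) (# 0) ∧' ∀' (# 0 ∈' # 1 ⇒' A1 A (# 0)) ∧' # 1 ∈' # 0))

idFᴬ : Fm 1 → Fmᴬ 2
idFᴬ A = A1 A (# 0) ∧' # 0 ≐' # 1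

compᴬ : Fm 2 → Fm 2 → Fmᴬ 2
compᴬ G F = ∃' (A2 F (# 1) (# 0) ∧' A2 G (# 0) (# 2))

×Fᴬ : Fm 2 → Fm 2 → Fmᴬ 2
×Fᴬ F G = ∃' (∃' (∃' (∃' (IsPair (# 4) (# 3) (# 2) ∧' IsPair (# 5) (# 1) (# 0) ∧' A2 F (# 3) (# 1) ∧' A2 G (# 2) (# 0)))))

pairFᴬ : Fm 2 → Fm 2 → Fmᴬ 2
pairFᴬ F G = ∃' (∃' (IsPair (# 3) (# 1) (# 0) ∧' A2 F (# 2) (# 1) ∧' A2 G (# 2) (# 0)))

proj₂Fᴬ : Fm 1 → Fm 1 → Fmᴬ 2
proj₂Fᴬ A B = ∃' (IsPair (# 1) (# 0) (# 2) ∧' A1 A (# 0) ∧' A1 B (# 2))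

eXᴬ : Fm 1 → Fmᴬ 2
eXᴬ P = A1 (MemX P) (# 0) ∧' # 0 ≐' # 1

idArrow : (X : Fm 1) → Arrow X X
idArrow X = mkArrow X X (idFᴬ X)
  (∧i (∧e1 h0) (subst-A1 (∧e2 h0) (∧e1 h0)))
  (≐trans (≐sym (∧e2 (unfold₂ (idFᴬ X) (∧e1 h0)))) (∧e2 (unfold₂ (idFᴬ X) (∧e2 h0))))
  (∃i (# 0) (fold₂ (idFᴬ X) (∧i h0 (rfl (# 0)))))

MemX-∈ : ∀ {P Γ} {d x t : Fin n} →
  Derᴬ n Γ (A1 (MemX P) d) → Derᴬ n Γ (IsPair d x t) → Derᴬ n Γ (x ∈' t)
MemX-∈ {P = P} dm dp = cut dm (cut (weaken₁ dp) (∃e (unfold₁ (MemXᴬ P) h1) (∃e h0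
  (subst-∈ʳ (pair-injectiveʳ (∧e1 h0) h2) (subst-∈ˡ (pair-injectiveˡ (∧e1 h0) h2) (∧e2 (∧e2 h0)))))))

Injective : ∀ {S T} → Arrow S T → Set
Injective m = ∀ {n Γ} {s s' v : Fin n} →
  Derᴬ n Γ (A2 (fm m) s v) → Derᴬ n Γ (A2 (fm m) s' v) → Derᴬ n Γ (s ≐' s')

FirstSubsetOfSecond : ∀ {S} A B → Arrow S (A ⊗ B) → Set
FirstSubsetOfSecond A B m = ∀ {n Γ} {s v a y x : Fin n} →
  Derᴬ n Γ (A2 (fm m) s v) → Derᴬ n Γ (IsPair v a y) → Derᴬ n Γ (x ∈' a) → Derᴬ n Γ (x ∈' y)

-- Kernel pairs

module KernelPair {S T : Fm 1} (m : Arrow S T) where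
  private M = fm m

  KernelPairᴬ : Fmᴬ 1
  KernelPairᴬ = ∃' (∃' (IsPair (# 2) (# 1) (# 0) ∧' A1 S (# 1) ∧' A1 S (# 0)
                        ∧' ∃' (A2 M (# 2) (# 0) ∧' A2 M (# 1) (# 0))))

  K : Fm 1
  K = ⟦ KernelPairᴬ ⟧

  kp₁ᴬ kp₂ᴬ : Fmᴬ 2
  kp₁ᴬ = A1 K (# 0) ∧' ∃' (IsPair (# 1) (# 2) (# 0))
  kp₂ᴬ = A1 K (# 0) ∧' ∃' (IsPair (# 1) (# 0) (# 2))

  kp₁ : Arrow K S
  kp₁ = mkArrow K S kp₁ᴬ
    (∧i (∧e1 h0) (∃e (unfold₁ KernelPairᴬ (∧e1 h0)) (∃e h0 (∃e (∧e2 h2)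
      (subst-A1 (pair-injectiveˡ (∧e1 h1) h0) (∧e1 (∧e2 h1)))))))
    (∃e (∧e2 (unfold₂ kp₁ᴬ (∧e1 h0))) (∃e (∧e2 (unfold₂ kp₁ᴬ (∧e2 h1))) (pair-injectiveˡ h1 h0)))
    (∃e (unfold₁ KernelPairᴬ h0) (∃e h0 (∃i (# 1) (fold₂ kp₁ᴬ (∧i h2 (∃i (# 0) (∧e1 h0)))))))

  kp₂ : Arrow K S
  kp₂ = mkArrow K S kp₂ᴬ
    (∧i (∧e1 h0) (∃e (unfold₁ KernelPairᴬ (∧e1 h0)) (∃e h0 (∃e (∧e2 h2)
      (subst-A1 (pair-injectiveʳ (∧e1 h1) h0) (∧e1 (∧e2 (∧e2 h1))))))))
    (∃e (∧e2 (unfold₂ kp₂ᴬ (∧e1 h0))) (∃e (∧e2 (unfold₂ kp₂ᴬ (∧e2 h1))) (pair-injectiveʳ h1 h0)))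
    (∃e (unfold₁ KernelPairᴬ h0) (∃e h0 (∃i (# 0) (fold₂ kp₂ᴬ (∧i h2 (∃i (# 1) (∧e1 h0)))))))

  kp-commutes : Derᴬ 2 [] (compᴬ M (fm kp₁) ⇔' compᴬ M (fm kp₂))
  kp-commutes = ⇔i
    (∃e h0 (∃e (unfold₁ KernelPairᴬ (∧e1 (unfold₂ kp₁ᴬ (∧e1 h0)))) (∃e h0 (∃e (∧e2 (unfold₂ kp₁ᴬ (∧e1 h2)))
      (∃e (∧e2 (∧e2 (∧e2 h1)))
        (cut (pair-injectiveˡ (∧e1 h2) h1)
        (cut (arrow-functional m (subst-A2ˡ (≐sym h0) (∧e2 h5)) (∧e1 h1))
          (∃i (# 2) (∧i (fold₂ kp₂ᴬ (∧i (∧e1 (unfold₂ kp₁ᴬ (∧e1 h6))) (∃i (# 3) (∧e1 h4))))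
                        (subst-A2ʳ (≐sym h0) (∧e2 h2)))))))))))
    (∃e h0 (∃e (unfold₁ KernelPairᴬ (∧e1 (unfold₂ kp₂ᴬ (∧e1 h0)))) (∃e h0 (∃e (∧e2 (unfold₂ kp₂ᴬ (∧e1 h2)))
      (∃e (∧e2 (∧e2 (∧e2 h1)))
        (cut (pair-injectiveʳ (∧e1 h2) h1)
        (cut (arrow-functional m (subst-A2ˡ (≐sym h0) (∧e2 h5)) (∧e2 h1))
          (∃i (# 3) (∧i (fold₂ kp₁ᴬ (∧i (∧e1 (unfold₂ kp₂ᴬ (∧e1 h6))) (∃i (# 2) (∧e1 h4))))
                        (subst-A2ʳ (≐sym h0) (∧e1 h2)))))))))))

  -- The two projections of the kernel pair agree, so each ⟨s, s'⟩ ∈ K has s ≐ s'.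
  mono⇒injective : Mono m → Injective m
  mono⇒injective mono {s = s} {s'} {v} d e = cut d (cut (weaken₁ e) (∃e (pair-exists s s')
    (cut (fold₁ KernelPairᴬ (∃i (suc s) (∃i (suc s') (∧i h0 (∧i (∧e1 (arrow-typed m h2))
            (∧i (∧e1 (arrow-typed m h1)) (∃i (suc v) (∧i h2 h1))))))))
      (∃e (∧e2 (⇔e→ (instantiate (kp₁ᴬ ⇔' kp₂ᴬ) kp₁≈kp₂ (pick2 (# 0) (suc s))) (∧i h0 (∃i (suc s') h1))))
         (pair-injectiveʳ h0 h2)))))
    where
    kp₁≈kp₂ : Der 2 [] ⟦ kp₁ᴬ ⇔' kp₂ᴬ ⟧
    kp₁≈kp₂ = mono K kp₁ kp₂ (sound kp-commutes)

open KernelPair using (mono⇒injective)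

module Components {S A B : Fm 1} (m : Arrow S (A ⊗ B)) where
  private M = fm m

  fstᴬ sndᴬ : Fmᴬ 2
  fstᴬ = ∃' (A2 M (# 1) (# 0) ∧' ∃' (IsPair (# 1) (# 3) (# 0)))
  sndᴬ = ∃' (A2 M (# 1) (# 0) ∧' ∃' (IsPair (# 1) (# 0) (# 3)))

  private
    ⊗-elim : ∀ {Γ} {v : Fin n} → Derᴬ n Γ (A1 (A ⊗ B) v) →
      Derᴬ n Γ (∃' (∃' (IsPair (suc (suc v)) (# 1) (# 0) ∧' A1 A (# 1) ∧' A1 B (# 0))))
    ⊗-elim = unfold₁ (⊗ᴬ A B)

  fst : Arrow S A
  fst = mkArrow S A fstᴬ
    (∃e h0 (∃e (∧e2 h0) (∃e (⊗-elim (∧e2 (arrow-typed m (∧e1 h1)))) (∃e h0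
       (∧i (∧e1 (arrow-typed m (∧e1 h3))) (subst-A1 (pair-injectiveˡ (∧e1 h0) h2) (∧e1 (∧e2 h0))))))))
    (∃e (unfold₂ fstᴬ (∧e1 h0)) (∃e (∧e2 h0) (∃e (unfold₂ fstᴬ (∧e2 h2)) (∃e (∧e2 h0)
       (pair-injectiveˡ (subst-pair (arrow-functional m (∧e1 h3) (∧e1 h1)) h2) h0)))))
    (∃e (arrow-total m h0) (∃e (⊗-elim (∧e2 (arrow-typed m h0))) (∃e h0
       (∃i (# 1) (fold₂ fstᴬ (∃i (# 2) (∧i h2 (∃i (# 0) (∧e1 h0)))))))))

  snd : Arrow S B
  snd = mkArrow S B sndᴬ
    (∃e h0 (∃e (∧e2 h0) (∃e (⊗-elim (∧e2 (arrow-typed m (∧e1 h1)))) (∃e h0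
       (∧i (∧e1 (arrow-typed m (∧e1 h3))) (subst-A1 (pair-injectiveʳ (∧e1 h0) h2) (∧e2 (∧e2 h0))))))))
    (∃e (unfold₂ sndᴬ (∧e1 h0)) (∃e (∧e2 h0) (∃e (unfold₂ sndᴬ (∧e2 h2)) (∃e (∧e2 h0)
       (pair-injectiveʳ (subst-pair (arrow-functional m (∧e1 h3) (∧e1 h1)) h2) h0)))))
    (∃e (arrow-total m h0) (∃e (⊗-elim (∧e2 (arrow-typed m h0))) (∃e h0
       (∃i (# 0) (fold₂ sndᴬ (∃i (# 2) (∧i h2 (∃i (# 1) (∧e1 h0)))))))))

  fst-intro : ∀ {Γ} {s v a y : Fin n} →
    Derᴬ n Γ (A2 M s v) → Derᴬ n Γ (IsPair v a y) → Derᴬ n Γ (A2 (fm fst) s a)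
  fst-intro {v = v} {y = y} dm dp = fold₂ fstᴬ (∃i v (∧i dm (∃i y dp)))

  snd-elim : ∀ {Γ} {s t v a y : Fin n} →
    Derᴬ n Γ (A2 (fm snd) s t) → Derᴬ n Γ (A2 M s v) → Derᴬ n Γ (IsPair v a y) → Derᴬ n Γ (t ≐' y)
  snd-elim da db dc = cut da (cut (weaken₁ db) (cut (weaken₁ (weaken₁ dc)) (∃e (unfold₂ sndᴬ h2) (∃e (∧e2 h0)
     (cut (arrow-functional m h3 (∧e1 h1)) (pair-injectiveʳ (subst-pair (≐sym h0) h1) h3))))))

  m∘id≈⟨fst,snd⟩ : Derᴬ 2 [] (compᴬ M (fm (idArrow S)) ⇔' pairFᴬ (fm fst) (fm snd))
  m∘id≈⟨fst,snd⟩ = ⇔i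
    (∃e h0 (cut (subst-A2ˡ (≐sym (∧e2 (unfold₂ (idFᴬ S) (∧e1 h0)))) (∧e2 h0))
       (∃e (⊗-elim (∧e2 (arrow-typed m h0))) (∃e h0
         (∃i (# 1) (∃i (# 0) (∧i (∧e1 h0) (∧i
            (fold₂ fstᴬ (∃i (# 4) (∧i h2 (∃i (# 0) (∧e1 h0)))))
            (fold₂ sndᴬ (∃i (# 4) (∧i h2 (∃i (# 1) (∧e1 h0)))))))))))))
    (∃e h0 (∃e h0 (∃e (unfold₂ fstᴬ (∧e1 (∧e2 h0))) (∃e (∧e2 h0)
       (∃e (unfold₂ sndᴬ (∧e2 (∧e2 h2))) (∃e (∧e2 h0)
         (cut (arrow-functional m (∧e1 h3) (∧e1 h1))
         (cut (subst-pairˡ (pair-injectiveˡ (subst-pair (≐sym h0) h1) h3) (subst-pair (≐sym h0) h1))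
         (cut (pair-unique h0 (∧e1 h6))
           (∃i (# 6) (∧i (fold₂ (idFᴬ S) (∧i (∧e1 (arrow-typed m (∧e1 h6))) (rfl (# 6))))
                         (subst-A2ʳ h0 (∧e1 h6)))))))))))))

-- The pullback of e_X along id × f

module CanonicalPullback (P : Fm 1) {Z : Fm 1} (f : Arrow Z (𝒫S P)) where
  private F = fm f

  id×fᴬ : Fmᴬ 2
  id×fᴬ = ×Fᴬ (idF P) F

  id×f : Fm 2
  id×f = ⟦ id×fᴬ ⟧

  id×f-functional : ∀ {Γ} {w d d' : Fin n} →
    Derᴬ n Γ (A2 id×f w d) → Derᴬ n Γ (A2 id×f w d') → Derᴬ n Γ (d ≐' d')
  id×f-functional d1 d2 = cut d1 (cut (weaken₁ d2) (∃e (unfold₂ id×fᴬ h1) (∃e h0 (∃e h0 (∃e h0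
    (∃e (unfold₂ id×fᴬ h4) (∃e h0 (∃e h0 (∃e h0
      (cut (pair-injectiveˡ (∧e1 h4) (∧e1 h0))
      (cut (∧e2 (unfold₂ (idFᴬ P) (∧e1 (∧e2 (∧e2 h5)))))
      (cut (∧e2 (unfold₂ (idFᴬ P) (∧e1 (∧e2 (∧e2 h2)))))
      (cut (pair-injectiveʳ (∧e1 h7) (∧e1 h3))
      (cut (arrow-functional f (subst-A2ˡ h0 (∧e2 (∧e2 (∧e2 h8)))) (∧e2 (∧e2 (∧e2 h4))))
        (pair-unique (subst-pairʳ h0 (subst-pairˡ (≐trans (≐sym h3) (≐trans h4 h2)) (∧e1 (∧e2 h9))))
                     (∧e1 (∧e2 h5)))))))))))))))))

  id×f-total : ∀ {Γ} {w : Fin n} → Derᴬ n Γ (A1 (P ⊗ Z) w) → Derᴬ n Γ (∃' (A2 id×f (suc w) (# 0)))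
  id×f-total d = ∃e (unfold₁ (⊗ᴬ P Z) d) (∃e h0 (∃e (arrow-total f (∧e2 (∧e2 h0))) (∃e (pair-exists (# 2) (# 0))
    (∃i (# 0) (fold₂ id×fᴬ (∃i (# 3) (∃i (# 2) (∃i (# 3) (∃i (# 1)
      (∧i (∧e1 h2) (∧i h0 (∧i (fold₂ (idFᴬ P) (∧i (∧e1 (∧e2 h2)) (rfl (# 3)))) h1))))))))))))

  id×f-intro : ∀ {Γ} {w x z d a : Fin n} →
    Derᴬ n Γ (IsPair w x z) → Derᴬ n Γ (A1 P x) → Derᴬ n Γ (A2 F z a) → Derᴬ n Γ (IsPair d x a) →
    Derᴬ n Γ (A2 id×f w d)
  id×f-intro {x = x} {z} {a = a} dw dx df dd = fold₂ id×fᴬ (∃i x (∃i z (∃i x (∃i a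
    (∧i dw (∧i dd (∧i (fold₂ (idFᴬ P) (∧i dx (rfl x))) df)))))))

  id×f-elim : ∀ {Γ} {w d x z : Fin n} → Derᴬ n Γ (A2 id×f w d) → Derᴬ n Γ (IsPair w x z) →
    Derᴬ n Γ (∃' (IsPair (suc d) (suc x) (# 0) ∧' A2 F (suc z) (# 0)))
  id×f-elim dh dp = cut dh (cut (weaken₁ dp) (∃e (unfold₂ id×fᴬ h1) (∃e h0 (∃e h0 (∃e h0
    (cut (pair-injectiveˡ (∧e1 h0) h4)
    (cut (pair-injectiveʳ (∧e1 h1) h5)
    (cut (∧e2 (unfold₂ (idFᴬ P) (∧e1 (∧e2 (∧e2 h2)))))
      (∃i (# 0) (∧i (subst-pairˡ (≐trans (≐sym h0) h2) (∧e1 (∧e2 h3))) (subst-A2ˡ h1 (∧e2 (∧e2 (∧e2 h3))))))))))))))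

  Pbᴬ : Fmᴬ 1
  Pbᴬ = A1 (P ⊗ Z) (# 0) ∧' ∃' (A2 id×f (# 1) (# 0) ∧' A1 (MemX P) (# 0))

  Pb : Fm 1
  Pb = ⟦ Pbᴬ ⟧

  πᴬ qᴬ : Fmᴬ 2
  πᴬ = A1 Pb (# 0) ∧' # 0 ≐' # 1
  qᴬ = A1 Pb (# 0) ∧' A2 id×f (# 0) (# 1)

  Pb-intro : ∀ {Γ} {w d : Fin n} → Derᴬ n Γ (A1 (P ⊗ Z) w) → Derᴬ n Γ (A2 id×f w d) →
    Derᴬ n Γ (A1 (MemX P) d) → Derᴬ n Γ (A1 Pb w)
  Pb-intro {d = d} a b c = fold₁ Pbᴬ (∧i a (∃i d (∧i b c)))

  Pb-MemX : ∀ {Γ} {w d : Fin n} → Derᴬ n Γ (A1 Pb w) → Derᴬ n Γ (A2 id×f w d) → Derᴬ n Γ (A1 (MemX P) d)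
  Pb-MemX a b = cut b (∃e (∧e2 (unfold₁ Pbᴬ (weaken₁ a))) (subst-A1 (id×f-functional (∧e1 h0) h1) (∧e2 h0)))

  π : Arrow Pb (P ⊗ Z)
  π = mkArrow Pb (P ⊗ Z) πᴬ
    (∧i (∧e1 h0) (subst-A1 (∧e2 h0) (∧e1 (unfold₁ Pbᴬ (∧e1 h0)))))
    (≐trans (≐sym (∧e2 (unfold₂ πᴬ (∧e1 h0)))) (∧e2 (unfold₂ πᴬ (∧e2 h0))))
    (∃i (# 0) (fold₂ πᴬ (∧i h0 (rfl (# 0)))))

  q : Arrow Pb (MemX P)
  q = mkArrow Pb (MemX P) qᴬ
    (∧i (∧e1 h0) (Pb-MemX (∧e1 h0) (∧e2 h0)))
    (id×f-functional (∧e2 (unfold₂ qᴬ (∧e1 h0))) (∧e2 (unfold₂ qᴬ (∧e2 h0))))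
    (∃e (∧e2 (unfold₁ Pbᴬ h0)) (∃i (# 0) (fold₂ qᴬ (∧i h1 (∧e1 h0)))))

  commutes : Derᴬ 2 [] (compᴬ (eX P) (fm q) ⇔' compᴬ id×f (fm π))
  commutes = ⇔i
    (∃e h0 (∃i (# 1) (∧i (fold₂ πᴬ (∧i (∧e1 (unfold₂ qᴬ (∧e1 h0))) (rfl (# 1))))
                        (subst-A2ʳ (∧e2 (unfold₂ (eXᴬ P) (∧e2 h0))) (∧e2 (unfold₂ qᴬ (∧e1 h0)))))))
    (∃e h0 (cut (subst-A2ˡ (≐sym (∧e2 (unfold₂ πᴬ (∧e1 h0)))) (∧e2 h0))
       (∃i (# 2) (∧i (fold₂ qᴬ (∧i (∧e1 (unfold₂ πᴬ (∧e1 h1))) h0))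
                     (fold₂ (eXᴬ P) (∧i (Pb-MemX (∧e1 (unfold₂ πᴬ (∧e1 h1))) h0) (rfl (# 2))))))))

  -- A cone (a, b) over the cospan is mediated by a itself, read as an arrow into Pb ⊆ P ⊗ Z.
  universal : (W : Fm 1) (a : Arrow W (P ⊗ Z)) (b : Arrow W (MemX P)) →
    comp (eX P) (fm b) ≈ comp id×f (fm a) →
    Σ (Arrow W Pb) λ u →
      (comp (fm π) (fm u) ≈ fm a) × (comp (fm q) (fm u) ≈ fm b) ×
      ((u' : Arrow W Pb) → comp (fm π) (fm u') ≈ fm a →
         comp (fm q) (fm u') ≈ fm b → fm u' ≈ fm u)
  universal W a b cone = u , sound π∘u≈a , sound q∘u≈b , unique
    where
    A B : Fm 2
    A = fm a
    B = fm b
    cone-at : ∀ {k Γ} (w d : Fin k) → Derᴬ k Γ (renᴬ (pick2 w d) (compᴬ (eX P) B ⇔' compᴬ id×f A))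
    cone-at w d = instantiate (compᴬ (eX P) B ⇔' compᴬ id×f A) cone (pick2 w d)
    a-in-Pb : ∀ {k Γ} {w p : Fin k} → Derᴬ k Γ (A2 A w p) → Derᴬ k Γ (A1 Pb p)
    a-in-Pb {w = w} {p} d = cut d (∃e (id×f-total (∧e2 (arrow-typed a h0)))
      (∃e (⇔e← (cone-at (suc w) (# 0)) (∃i (suc p) (∧i h1 h0)))
        (Pb-intro (∧e2 (arrow-typed a h2)) h1
          (subst-A1 (∧e2 (unfold₂ (eXᴬ P) (∧e2 h0))) (∧e1 (unfold₂ (eXᴬ P) (∧e2 h0)))))))
    u : Arrow W Pb
    u = arr A (record
      { typed      = sound {Γ = R2 A ∷ []} (∧i (∧e1 (arrow-typed a (R2⇒A2 h0))) (a-in-Pb (R2⇒A2 h0)))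
      ; functional = IsArrow.functional (isArr a)
      ; total      = IsArrow.total (isArr a) })
    π∘u≈a : Derᴬ 2 [] (compᴬ (fm π) A ⇔' R2 A)
    π∘u≈a = ⇔i (∃e h0 (subst-A2ʳ (∧e2 (unfold₂ πᴬ (∧e2 h0))) (∧e1 h0)))
               (∃i (# 1) (∧i (R2⇒A2 h0) (fold₂ πᴬ (∧i (a-in-Pb (R2⇒A2 h0)) (rfl (# 1))))))
    q∘u≈b : Derᴬ 2 [] (compᴬ (fm q) A ⇔' R2 B)
    q∘u≈b = ⇔i
      (∃e h0 (∃e (⇔e← (cone-at (# 1) (# 2)) (∃i (# 0) (∧i (∧e1 h0) (∧e2 (unfold₂ qᴬ (∧e2 h0))))))
         (subst-A2ʳ (∧e2 (unfold₂ (eXᴬ P) (∧e2 h0))) (∧e1 h0))))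
      (∃e (⇔e→ (cone-at (# 0) (# 1)) (∃i (# 1) (∧i (R2⇒A2 h0)
            (fold₂ (eXᴬ P) (∧i (∧e2 (arrow-typed b (R2⇒A2 h0))) (rfl (# 1)))))))
         (∃i (# 0) (∧i (∧e1 h0) (fold₂ qᴬ (∧i (a-in-Pb (∧e1 h0)) (∧e2 h0))))))
    unique : (u' : Arrow W Pb) → comp (fm π) (fm u') ≈ A → comp (fm q) (fm u') ≈ B → fm u' ≈ A
    unique u' π∘u'≈a _ = sound {Γ = []} {φ = R2 (fm u') ⇔' R2 A} (⇔i
        (A2⇒R2 (⇔e→ π∘u'≈a-at (∃i (# 1) (∧i (R2⇒A2 h0)
          (fold₂ πᴬ (∧i (∧e2 (arrow-typed u' (R2⇒A2 h0))) (rfl (# 1))))))))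
        (∃e (⇔e← π∘u'≈a-at (R2⇒A2 h0)) (subst-A2ʳ (∧e2 (unfold₂ πᴬ (∧e2 h0))) (∧e1 h0))))
      where
      π∘u'≈a-at : ∀ {Γ} → Derᴬ 2 Γ (renᴬ (pick2 (# 0) (# 1)) (compᴬ (fm π) (fm u') ⇔' R2 A))
      π∘u'≈a-at = instantiate (compᴬ (fm π) (fm u') ⇔' R2 A) π∘u'≈a (pick2 (# 0) (# 1))

  isPullback : IsPullback (P ⊗ Z) (MemX P) (P ⊗ 𝒫S P) (eX P) id×f Pb π q
  isPullback = record { commutes = sound commutes ; universal = universal }

module _ (P : Fm 1) {S : Fm 1} (m : Arrow S (𝒫S P ⊗ 𝒫S P)) where
  open Components {A = 𝒫S P} {B = 𝒫S P} m
  private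
    module Pb₁ = CanonicalPullback P fst
    module Pb₂ = CanonicalPullback P snd

  -- For x ∈ a = fst s, ⟨x, s⟩ lies in the pullback along id × fst, hence (as m factors through
  -- itself) in the one along id × snd, so x ∈ snd s = y.
  charSubset⇒firstSubsetOfSecond : CharSubset P S m → FirstSubsetOfSecond (𝒫S P) (𝒫S P) m
  charSubset⇒firstSubsetOfSecond char {s = s} {v} {a} {y} {x} dm dp dx =
    cut dm (cut (weaken₁ dp) (cut (weaken₁ (weaken₁ dx))
    (cut (fst-intro h2 h1)
    (cut (⇒e (∀e (unfold₁ (𝒫Sᴬ P) (∧e2 (arrow-typed fst h0))) x) h1)
    (∃e (pair-exists x s)
    (∃e (pair-exists (suc x) (suc a))
    (cut (Pb₁.Pb-intro
           (fold₁ (⊗ᴬ P S) (∃i (suc (suc x)) (∃i (suc (suc s)) (∧i h1 (∧i h2 (∧e1 (arrow-typed m h6)))))))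
           (Pb₁.id×f-intro h1 h2 h3 h0)
           (fold₁ (MemXᴬ P) (∃i (suc (suc x)) (∃i (suc (suc a))
             (∧i h0 (∧i (unfold₁ (𝒫Sᴬ P) (∧e2 (arrow-typed fst h3))) h4))))))
    (∃e (∧e2 (unfold₁ Pb₂.Pbᴬ (Pb₁⊆Pb₂ h0)))
    (∃e (Pb₂.id×f-elim (∧e1 h0) h3)
      (subst-∈ʳ (snd-elim (∧e2 h0) h9 h8) (MemX-∈ (∧e2 h1) (∧e1 h0))))))))))))
    where
    factorization : Factors Pb₁.Pb Pb₂.Pb (P ⊗ S) (fm Pb₁.π) Pb₂.π
    factorization = proj₁ (char S fst snd) (idArrow S , sound m∘id≈⟨fst,snd⟩)
      Pb₁.Pb Pb₁.π Pb₁.q Pb₁.isPullback Pb₂.Pb Pb₂.π Pb₂.q Pb₂.isPullback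
    Pb₁⊆Pb₂ : ∀ {k Γ} {w : Fin k} → Derᴬ k Γ (A1 Pb₁.Pb w) → Derᴬ k Γ (A1 Pb₂.Pb w)
    Pb₁⊆Pb₂ {w = w} d = cut d (∃e (⇔e← (instantiate (compᴬ (fm Pb₂.π) (fm (proj₁ factorization)) ⇔' Pb₁.πᴬ)
        (proj₂ factorization) (pick2 w w)) (∧i h0 (rfl w)))
      (subst-A1 (∧e2 (unfold₂ Pb₂.πᴬ (∧e2 h0))) (∧e1 (unfold₂ Pb₂.πᴬ (∧e2 h0)))))

-- Fibres of π₂

IsPowerset : Fin n → Fin n → Fmᴬ n
IsPowerset p y = ∀' (∀' (# 0 ∈' # 1 ⇒' # 0 ∈' suc (suc y)) ⇒' # 0 ∈' suc p)

Separated : Fin n → Fin n → Fmᴬ (suc n) → Fmᴬ n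
Separated b a χ = ∀' (# 0 ∈' suc b ⇔' (# 0 ∈' suc a ∧' χ))

module _ {S : Fm 1} (A B : Fm 1) (m : Arrow S (A ⊗ B)) where
  private M = fm m

  PreimageOf : Fin n → Fin n → Fin n → Fmᴬ n
  PreimageOf s a y = ∃' (A2 M (suc s) (# 0) ∧' IsPair (# 0) (suc a) (suc y))

  subst-PreimageOf : ∀ {Γ} {s s' a y : Fin n} →
    Derᴬ n Γ (s ≐' s') → Derᴬ n Γ (PreimageOf s a y) → Derᴬ n Γ (PreimageOf s' a y)
  subst-PreimageOf {a = a} {y} = sbst (PreimageOf (# 0) (suc a) (suc y))

  PreimageOf-unique : Injective m → ∀ {Γ} {s s' a y : Fin n} →
    Derᴬ n Γ (PreimageOf s a y) → Derᴬ n Γ (PreimageOf s' a y) → Derᴬ n Γ (s ≐' s')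
  PreimageOf-unique injective d d' = cut d (cut (weaken₁ d') (∃e h1 (∃e h1
    (injective (subst-A2ʳ (pair-unique (∧e2 h1) (∧e2 h0)) (∧e1 h1)) (∧e1 h0)))))

  PreimageOf-functional : Injective m → ∀ {Γ} {b p y : Fin n} →
    Derᴬ n Γ (Separated b p (∃' (PreimageOf (# 0) (# 1) (suc (suc y))))) →
    Derᴬ n Γ (∀' (# 0 ∈' suc b ⇒' ∃' (∀' (PreimageOf (# 0) (# 2) (suc (suc (suc y))) ⇔' # 0 ≐' # 1))))
  PreimageOf-functional injective dsep = cut dsep (∀i (⇒i (∃e (∧e2 (⇔e→ (∀e h1 (# 0)) h0))
    (∃i (# 0) (∀i (⇔i (PreimageOf-unique injective h0 h1) (subst-PreimageOf (≐sym h0) h1)))))))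

  fibre⊆replacement : Injective m → FirstSubsetOfSecond A B m → ∀ {Γ} {x y p b r : Fin n} →
    Derᴬ n Γ (IsPowerset p y) →
    Derᴬ n Γ (Separated b p (∃' (PreimageOf (# 0) (# 1) (suc (suc y))))) →
    Derᴬ n Γ (∀' (# 0 ∈' suc b ⇒' ∃' (# 0 ∈' suc (suc r) ∧' PreimageOf (# 0) (# 1) (suc (suc y))))) →
    Derᴬ n Γ (A2 (comp (proj₂F A B) M) x y) → Derᴬ n Γ (x ∈' r)
  fibre⊆replacement injective first⊆second {x = x} dpow dsep drep dx =
    cut dpow (cut (weaken₁ dsep) (cut (weaken₁ (weaken₁ drep)) (cut (weaken₁ (weaken₁ (weaken₁ dx)))
    (∃e (unfold₂ (compᴬ (proj₂F A B) M) h0) (∃e (unfold₂ (proj₂Fᴬ A B) (∧e2 h0))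
    (cut (∀i (⇒i (first⊆second (∧e1 h2) (∧e1 h1) h0)))
    (cut (⇒e (∀e h6 (# 0)) h0)
    (cut (⇔e← (∀e h6 (# 0)) (∧i h0 (∃i (suc (suc x)) (∃i (# 1) (∧i (∧e1 h3) (∧e1 h2))))))
    (∃e (⇒e (∀e h6 (# 0)) h0) (∃e (∧e2 h0)
    (cut (pair-unique (∧e1 h5) (∧e2 h0))
    (cut (injective (subst-A2ʳ (≐sym h0) (∧e1 h1)) (∧e1 h7))
      (subst-∈ˡ h0 (∧e1 h3))))))))))))))

  -- The fibre over y is the image of {a ∈ 𝒫(y) | ⟨a, y⟩ ∈ im m} under the partial inverse of m.
  injective∧firstSubsetOfSecond⇒small : Injective m → FirstSubsetOfSecond A B m →
    Small (comp (proj₂F A B) M)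
  injective∧firstSubsetOfSecond⇒small injective first⊆second = sound fibres-are-sets
    where
    fibres-are-sets : Derᴬ 0 [] (∀' (∃' (∀' (A2 (comp (proj₂F A B) M) (# 0) (# 2) ⇔' # 0 ∈' # 1))))
    fibres-are-sets = ∀i
      (∃e (∀e powerset-ax (# 0))
      (∃e (∀e (separation-ax (∃' (PreimageOf (# 0) (# 1) (# 3)))) (# 0))
      (∃e (⇒e (∀e (replacement-ax (PreimageOf (# 1) (# 0) (# 4))) (# 0)) (PreimageOf-functional injective h0))
      (∃e (∀e (separation-ax (A2 (comp (proj₂F A B) M) (# 0) (# 4))) (# 0))
        (∃i (# 0) (∀i (⇔i
          (⇔e← (∀e h1 (# 0)) (∧i (fibre⊆replacement injective first⊆second h4 h3 h2 h0) h0))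
          (∧e2 (⇔e→ (∀e h1 (# 0)) h0)))))))))

mainTheorem6 : (P S : Fm 1) (m : Arrow S (𝒫S P ⊗ 𝒫S P)) →
    Mono m → CharSubset P S m →
    Small (comp (proj₂F (𝒫S P) (𝒫S P)) (fm m))
mainTheorem6 P S m mono char =
  injective∧firstSubsetOfSecond⇒small (𝒫S P) (𝒫S P) m
    (mono⇒injective m mono)
    (charSubset⇒firstSubsetOfSecond P m char)
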